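{- Let $n,q,s,t$ be positive integers, $q\ge2$, and let $C\subseteq[q]^n$ be a $t$-design in $H(n,q)$ with degree $s$. Let $S'(C)=\{n-\partial(x,y)\mid x,y\in C,x\ne y\}=\{x_1,\ldots,x_s\}$, let $\lambda_i=|C|/q^i$, let $P_s(z)=\prod_{i=1}^s(z-x_i)$, and let $F_j^{(k)}$ ($k\ge1$, $0\le j\le k$) be defined by $F_0^{(k)}=1$, $F_k^{(k)}=x_1\cdots x_k$, and $F_j^{(k)}=F_j^{(k-1)}+(x_k-k+j)F_{j-1}^{(k-1)}$ for $k\ge2$, $1\le j\le k-1$. Then: (1) if $t\ge s$, then $\sum_{j=0}^s(-1)^j(n)_{s-j}\lambda_{s-j}F_j^{(s)}=P_s(n)$; (2) if $t\ge 2s-1$, then $\sum_{j=0}^s(-1)^j(n-\ell)_{s-j}\lambda_{s-j}F_j^{(s)}=0$ for every $1\le\ell\le s-1$.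
   Context: $[q]=\{1,\ldots,q\}$; $\partial$ is Hamming distance. A nonempty $C\subseteq[q]^n$ is a $t$-design in the Hamming scheme $H(n,q)$ if the array of its elements (as rows) is an orthogonal array of strength $t$: in any $t$ columns every element of $[q]^t$ occurs equally often. The degree of $C$ is $|\{\partial(x,y):x,y\in C,x\ne y\}|$. $(z)_i$ denotes the falling factorial $z(z-1)\cdots(z-i+1)$, with $(z)_0=1$. -}

module Defs where

open import Data.Nat as ℕ using (ℕ; zero; suc; _≟_; _<?_)
open import Data.Fin as Fin using (Fin)
import Data.Fin.Properties as FinP
open import Data.Vec using (Vec; lookup; tabulate; zipWith; toList)
open import Data.Vec.Properties using (≡-dec)
open import Data.List as List using (List; []; _∷_; length; filter; deduplicate; concatMap)
open import Data.Integer as ℤ using (ℤ; +_)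
open import Data.Rational as ℚ using (ℚ; 0ℚ; 1ℚ; _+_; _*_; _-_; -_)
open import Data.Product using (Σ; _×_; _,_)
open import Data.List.Membership.Propositional using (_∈_)
open import Relation.Nullary using (¬_; yes; no; does)
open import Relation.Nullary.Decidable using (¬?)
open import Relation.Binary.PropositionalEquality using (_≡_)
open import Data.Bool using (if_then_else_)

Word : ℕ → ℕ → Set
Word n q = Vec (Fin q) n

ham : ∀ {n q} → Word n q → Word n q → ℕ
ham {n} x y = length (filter (λ i → ¬? (lookup x i Fin.≟ lookup y i)) (List.allFin n))

restrict : ∀ {n q t} → Word n q → (Fin t → Fin n) → Vec (Fin q) t
restrict c cols = tabulate (λ i → lookup c (cols i))

countPattern : ∀ {n q t} → List (Word n q) → (Fin t → Fin n) → Vec (Fin q) t → ℕ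
countPattern C cols a = length (filter (λ c → ≡-dec Fin._≟_ (restrict c cols) a) C)

IsDesign : ∀ {n q} → ℕ → List (Word n q) → Set
IsDesign {n} {q} t C =
  (cols : Fin t → Fin n) → (∀ i j → cols i ≡ cols j → i ≡ j) →
  (a b : Vec (Fin q) t) → countPattern C cols a ≡ countPattern C cols b

distances : ∀ {n q} → List (Word n q) → List ℕ
distances C = concatMap (λ x → concatMap (λ y →
  if does (≡-dec Fin._≟_ x y) then [] else (ham x y ∷ [])) C) C

degree : ∀ {n q} → List (Word n q) → ℕ
degree C = length (deduplicate _≟_ (distances C))

InS' : ∀ {n q} → List (Word n q) → ℕ → Set
InS' {n} C d = Σ _ λ x → Σ _ λ y → x ∈ C × y ∈ C × ¬ (x ≡ y) × d ≡ n ℕ.∸ ham x y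

fromℕ : ℕ → ℚ
fromℕ m = (+ m) ℚ./ 1

-- N / d as a rational (d = 0 never occurs below since q ≥ 2).
frac : ℕ → ℕ → ℚ
frac N zero = 0ℚ
frac N (suc d) = (+ N) ℚ./ suc d

lam : ℕ → ℕ → ℕ → ℚ
lam N q i = frac N (q ℕ.^ i)

sign : ℕ → ℚ
sign zero = 1ℚ
sign (suc j) = - sign j

ff : ℚ → ℕ → ℚ
ff z zero = 1ℚ
ff z (suc i) = ff z i * (z - fromℕ i)

sumTo : ℕ → (ℕ → ℚ) → ℚ
sumTo zero f = f 0
sumTo (suc m) f = sumTo m f + f (suc m)

prodFrom1 : ℕ → (ℕ → ℚ) → ℚ
prodFrom1 zero f = 1ℚ
prodFrom1 (suc m) f = prodFrom1 m f * f (suc m)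

-- 1-based indexing x_i of a list (x_1 is the head); default 0 out of range.
nth1 : List ℕ → ℕ → ℚ
nth1 [] i = 0ℚ
nth1 (x ∷ xs) zero = 0ℚ
nth1 (x ∷ xs) (suc zero) = fromℕ x
nth1 (x ∷ xs) (suc (suc i)) = nth1 xs (suc i)

-- F_j^{(k)} for the sequence x_1, x_2, ...:
-- F_0^{(k)} = 1, F_k^{(k)} = x_1⋯x_k,
-- F_j^{(k)} = F_j^{(k-1)} + (x_k - k + j) F_{j-1}^{(k-1)} for 1 ≤ j ≤ k-1;
-- value 0 outside 0 ≤ j ≤ k (never used).
F : (ℕ → ℚ) → ℕ → ℕ → ℚ
F x k zero = 1ℚ
F x zero (suc j) = 0ℚ
F x (suc k) (suc j) with j ≟ k
... | yes _ = prodFrom1 (suc k) x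
... | no _ with j <? k
...   | yes _ = F x k (suc j) + (x (suc k) - fromℕ (suc k) + fromℕ (suc j)) * F x k j
...   | no _ = 0ℚ

P : (ℕ → ℚ) → ℕ → ℚ → ℚ
P x s z = prodFrom1 s (λ i → z - x i)

{-# OPTIONS --safe #-}
module Submission where

-- Fix x ∈ C and write A y = n − ∂(x,y), D y = ∂(x,y). Counting, below a set of distinct columns with
-- prescribed values, the ordered choices of i further columns on which y agrees with x followed by ℓ on
-- which it does not, and removing one column at a time, the strength-t property of C gives
--   q^(i+ℓ) Σ_{y∈C} (A y)_i (D y)_ℓ = |C| (n)_(i+ℓ) (q−1)^ℓ   for i + ℓ ≤ t.
-- Using (n)_(ℓ+i) = (n)_ℓ (n−ℓ)_i and Σ_j (−1)^j (z)_(s−j) F_j^(s) = P_s(z), the left-hand side of (2)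
-- (of (1) when ℓ = 0) times K = (n)_ℓ (q−1)^ℓ equals Σ_{y∈C} q^ℓ P_s(A y) (D y)_ℓ. Every y ≠ x
-- contributes 0, as A y ∈ S′(C) is a root of P_s. The term of x is P_s(n) for ℓ = 0, where K = 1,
-- and vanishes for ℓ ≥ 1 because D x = 0; then K ≠ 0 gives (2).

open import Algebra.Bundles using (CommutativeMonoid; CommutativeRing)
open import Data.Bool using (Bool; true; false; not; _∧_; T)
open import Data.Bool.Properties using (T-≡; T-not-≡)
open import Data.Empty using (⊥-elim)
open import Data.Fin as Fin using (Fin; _≟_)
import Data.Fin.Properties as FinP
import Data.Integer as ℤ
import Data.Integer.Properties as ℤP
open import Data.List as List using (List; []; _∷_; length; filter)
open import Data.List.Membership.Propositional using (_∈_)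
open import Data.List.Membership.Propositional.Properties using (∈-lookup)
import Data.List.Properties as ListP
open import Data.List.Relation.Unary.All as All using (All)
import Data.List.Relation.Unary.AllPairs as AllPairs
open import Data.List.Relation.Unary.Any using (here; there)
open import Data.List.Relation.Unary.Unique.Propositional using (Unique)
open import Data.Nat as ℕ using (ℕ; zero; suc; _∸_; _≤_; _<_)
open import Data.Nat.Combinatorics.Base using (_P′_)
import Data.Nat.Properties as ℕP
open import Algebra.Properties.CommutativeSemigroup ℕP.*-commutativeSemigroup using (x∙yz≈y∙xz)
open import Data.Product using (∃; _×_; _,_; proj₁; proj₂)
import Data.Rational.Properties as ℚP
open import Data.Rational.Solver using (module +-*-Solver)
open +-*-Solver using (solve; _:=_; _:+_; _:*_; :-_; _:-_; con)
import Data.Rational.Unnormalised as ℚᵘ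
import Data.Rational.Unnormalised.Properties as ℚᵘP
open import Data.Unit using (⊤; tt)
open import Data.Vec using (Vec; []; _∷_; lookup)
open import Data.Vec.Properties using (≡-dec)
open import Function using (_∘_)
open import Function.Bundles using (_⇔_; Equivalence)
open import Relation.Binary.PropositionalEquality
open import Relation.Nullary using (Dec; yes; no; does; ¬_; ¬?)
open import Relation.Nullary.Decidable using (dec-true; dec-false)

open import Defs

module Counting where

  open import Data.Nat using (_+_; _*_; _^_)
  open import Algebra.Properties.Semiring.Sum ℕP.+-*-semiring
  open import Data.Nat.Tactic.RingSolver using (solve-∀)
  open ≡-Reasoning

  𝟙 : Bool → ℕ
  𝟙 true = 1
  𝟙 false = 0

  𝟙-∧ : ∀ a b → 𝟙 (a ∧ b) ≡ 𝟙 a * 𝟙 b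
  𝟙-∧ false b = refl
  𝟙-∧ true b = sym (ℕP.+-identityʳ (𝟙 b))

  𝟙-partition : ∀ b x → 𝟙 b * x + 𝟙 (not b) * x ≡ x
  𝟙-partition false x = ℕP.+-identityʳ x
  𝟙-partition true x = trans (ℕP.+-identityʳ _) (ℕP.+-identityʳ x)

  𝟙*-cong : ∀ b {x y} → (T b → x ≡ y) → 𝟙 b * x ≡ 𝟙 b * y
  𝟙*-cong false _ = refl
  𝟙*-cong true x≡y = cong (_+ 0) (x≡y tt)

  T-does : ∀ {A : Set} (a? : Dec A) → T (does a?) → A
  T-does (yes a) _ = a

  ∸-suc : ∀ a m → a ∸ m ∸ 1 ≡ a ∸ suc m
  ∸-suc a m = trans (ℕP.∸-+-assoc a m 1) (cong (a ∸_) (ℕP.+-comm m 1))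

  ≟-does-sym : ∀ {k} (u v : Fin k) → does (u ≟ v) ≡ does (v ≟ u)
  ≟-does-sym u v with u ≟ v | v ≟ u
  ... | yes _   | yes _   = refl
  ... | no _    | no _    = refl
  ... | yes u≡v | no v≢u  = ⊥-elim (v≢u (sym u≡v))
  ... | no u≢v  | yes v≡u = ⊥-elim (u≢v (sym v≡u))

  ∑-const : ∀ n k → ∑[ i < n ] k ≡ n * k
  ∑-const zero k = refl
  ∑-const (suc n) k = cong (k +_) (∑-const n k)

  ∑-δ : ∀ {q} (u : Fin q) (f : Fin q → ℕ) → ∑[ v < q ] (𝟙 (does (u ≟ v)) * f v) ≡ f u
  ∑-δ {suc q} u f = begin
    ∑[ v < suc q ] (𝟙 (does (u ≟ v)) * f v)
      ≡⟨ sum-remove {i = u} (λ v → 𝟙 (does (u ≟ v)) * f v) ⟩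
    𝟙 (does (u ≟ u)) * f u + ∑[ v < q ] (𝟙 (does (u ≟ Fin.punchIn u v)) * f (Fin.punchIn u v))
      ≡⟨ cong₂ _+_ (cong (λ b → 𝟙 b * f u) (dec-true (u ≟ u) refl))
                   (sum-cong-≗ (λ v → cong (λ b → 𝟙 b * f (Fin.punchIn u v))
                                           (dec-false (u ≟ _) (FinP.punchInᵢ≢i u v ∘ sym)))) ⟩
    1 * f u + ∑[ v < q ] 0
      ≡⟨ cong₂ _+_ (ℕP.*-identityˡ (f u)) (sum-replicate-zero q) ⟩
    f u + 0
      ≡⟨ ℕP.+-identityʳ (f u) ⟩
    f u ∎

  ∑-split-at : ∀ {n} (d : Fin n) (f : Fin n → ℕ) →
               ∑[ c < n ] f c ≡ ∑[ c < n ] (𝟙 (not (does (d ≟ c))) * f c) + f d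
  ∑-split-at {n} d f = begin
    ∑[ c < n ] f c
      ≡⟨ sum-cong-≗ (λ c → sym (𝟙-partition (does (d ≟ c)) (f c))) ⟩
    ∑[ c < n ] (𝟙 (does (d ≟ c)) * f c + 𝟙 (not (does (d ≟ c))) * f c)
      ≡⟨ ∑-distrib-+ (λ c → 𝟙 (does (d ≟ c)) * f c) g ⟩
    ∑[ c < n ] (𝟙 (does (d ≟ c)) * f c) + ∑[ c < n ] (𝟙 (not (does (d ≟ c))) * f c)
      ≡⟨ cong (_+ sum g) (∑-δ d f) ⟩
    f d + ∑[ c < n ] (𝟙 (not (does (d ≟ c))) * f c)
      ≡⟨ ℕP.+-comm (f d) (sum g) ⟩
    ∑[ c < n ] (𝟙 (not (does (d ≟ c))) * f c) + f d ∎
    where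
    g : Fin n → ℕ
    g c = 𝟙 (not (does (d ≟ c))) * f c

  ∑-𝟙-≢ : ∀ {q} (u : Fin q) → ∑[ v < q ] 𝟙 (not (does (u ≟ v))) ≡ q ∸ 1
  ∑-𝟙-≢ {q} u = begin
    ∑[ v < q ] 𝟙 (not (does (u ≟ v)))
      ≡⟨ sum-cong-≗ (λ v → sym (ℕP.*-identityʳ (𝟙 (not (does (u ≟ v)))))) ⟩
    ∑[ v < q ] (𝟙 (not (does (u ≟ v))) * 1)
      ≡⟨ ℕP.m+n∸n≡m _ 1 ⟨
    ∑[ v < q ] (𝟙 (not (does (u ≟ v))) * 1) + 1 ∸ 1
      ≡⟨ cong (_∸ 1) (∑-split-at u (λ _ → 1)) ⟨
    ∑[ v < q ] 1 ∸ 1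
      ≡⟨ cong (_∸ 1) (trans (∑-const q 1) (ℕP.*-identityʳ q)) ⟩
    q ∸ 1 ∎

  ∑-𝟙*-scaled : ∀ {n} (b : Fin n → Bool) (f : Fin n → ℕ) p k → (∀ c → T (b c) → p * f c ≡ k) →
                 p * ∑[ c < n ] (𝟙 (b c) * f c) ≡ ∑[ c < n ] 𝟙 (b c) * k
  ∑-𝟙*-scaled {n} b f p k pf≡k = begin
    p * ∑[ c < n ] (𝟙 (b c) * f c)    ≡⟨ *-distribˡ-sum p (λ c → 𝟙 (b c) * f c) ⟩
    ∑[ c < n ] (p * (𝟙 (b c) * f c))  ≡⟨ sum-cong-≗ (λ c → x∙yz≈y∙xz p (𝟙 (b c)) (f c)) ⟩
    ∑[ c < n ] (𝟙 (b c) * (p * f c))  ≡⟨ sum-cong-≗ (λ c → 𝟙*-cong (b c) (pf≡k c)) ⟩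
    ∑[ c < n ] (𝟙 (b c) * k)          ≡⟨ *-distribʳ-sum k (𝟙 ∘ b) ⟨
    ∑[ c < n ] 𝟙 (b c) * k            ∎

  ∑-comm-*ˡ : ∀ {m k} (w : Fin k → ℕ) (g : Fin k → Fin m → ℕ) →
              ∑[ r < m ] ∑[ c < k ] (w c * g c r) ≡ ∑[ c < k ] (w c * ∑[ r < m ] g c r)
  ∑-comm-*ˡ w g = trans (∑-comm (λ r c → w c * g c r)) (sum-cong-≗ (λ c → sym (*-distribˡ-sum (w c) (g c))))

  ∑-𝟙-pos : ∀ {n} (b : Fin n → Bool) → 0 < ∑[ c < n ] 𝟙 (b c) → ∃ λ c → T (b c)
  ∑-𝟙-pos {suc n} b pos with b Fin.zero in eq
  ... | true = Fin.zero , subst T (sym eq) tt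
  ... | false with ∑-𝟙-pos (b ∘ Fin.suc) pos
  ...   | c , bc = Fin.suc c , bc

  length-filter-tabulate : ∀ {A : Set} {P : A → Set} (P? : ∀ a → Dec (P a)) {n} (f : Fin n → A) →
                           length (filter P? (List.tabulate f)) ≡ ∑[ i < n ] 𝟙 (does (P? (f i)))
  length-filter-tabulate P? {zero} f = refl
  length-filter-tabulate P? {suc n} f with does (P? (f Fin.zero))
  ... | true = cong suc (length-filter-tabulate P? (f ∘ Fin.suc))
  ... | false = length-filter-tabulate P? (f ∘ Fin.suc)

  ham-refl : ∀ {n q} (x : Word n q) → ham x x ≡ 0
  ham-refl {n} x = begin
    ham x x
      ≡⟨ length-filter-tabulate (λ c → ¬? (lookup x c ≟ lookup x c)) (λ c → c) ⟩
    ∑[ c < n ] 𝟙 (not (does (lookup x c ≟ lookup x c)))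
      ≡⟨ sum-cong-≗ (λ c → cong (𝟙 ∘ not) (dec-true (lookup x c ≟ lookup x c) refl)) ⟩
    ∑[ c < n ] 0
      ≡⟨ sum-replicate-zero n ⟩
    0 ∎

  module Columns {n : ℕ} where

    isFree : ∀ {m} → Vec (Fin n) m → Fin n → Bool
    isFree []       c = true
    isFree (d ∷ ds) c = not (does (d ≟ c)) ∧ isFree ds c

    Distinct : ∀ {m} → Vec (Fin n) m → Set
    Distinct []       = ⊤
    Distinct (d ∷ ds) = T (isFree ds d) × Distinct ds

    isFree-∷ : ∀ {m} d (ds : Vec (Fin n) m) {c} → T (isFree (d ∷ ds) c) → d ≢ c × T (isFree ds c)
    isFree-∷ d ds {c} free with d ≟ c
    ... | no d≢c = d≢c , free

    isFree⇒≢ : ∀ {m} (ds : Vec (Fin n) m) {c} → T (isFree ds c) → ∀ i → lookup ds i ≢ c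
    isFree⇒≢ (d ∷ ds) free Fin.zero    = proj₁ (isFree-∷ d ds free)
    isFree⇒≢ (d ∷ ds) free (Fin.suc i) = isFree⇒≢ ds (proj₂ (isFree-∷ d ds free)) i

    Distinct⇒lookup-injective : ∀ {m} (ds : Vec (Fin n) m) → Distinct ds →
                                ∀ i j → lookup ds i ≡ lookup ds j → i ≡ j
    Distinct⇒lookup-injective (d ∷ ds) _ Fin.zero Fin.zero _ = refl
    Distinct⇒lookup-injective (d ∷ ds) (free , _) Fin.zero (Fin.suc j) eq = ⊥-elim (isFree⇒≢ ds free j (sym eq))
    Distinct⇒lookup-injective (d ∷ ds) (free , _) (Fin.suc i) Fin.zero eq = ⊥-elim (isFree⇒≢ ds free i eq)
    Distinct⇒lookup-injective (d ∷ ds) (_ , distinct) (Fin.suc i) (Fin.suc j) eq =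
      cong Fin.suc (Distinct⇒lookup-injective ds distinct i j eq)

    ∑-isFree-remove : ∀ {m} (ds : Vec (Fin n) m) d (E : Fin n → ℕ) → T (isFree ds d) →
                      ∑[ c < n ] (𝟙 (isFree ds c) * E c) ≡ ∑[ c < n ] (𝟙 (isFree (d ∷ ds) c) * E c) + E d
    ∑-isFree-remove ds d E free = begin
      ∑[ c < n ] (𝟙 (isFree ds c) * E c)
        ≡⟨ ∑-split-at d (λ c → 𝟙 (isFree ds c) * E c) ⟩
      ∑[ c < n ] (𝟙 (not (does (d ≟ c))) * (𝟙 (isFree ds c) * E c)) + 𝟙 (isFree ds d) * E d
        ≡⟨ cong₂ _+_ (sum-cong-≗ λ c → trans (sym (ℕP.*-assoc (𝟙 (not (does (d ≟ c)))) _ _))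
                                              (cong (_* E c) (sym (𝟙-∧ (not (does (d ≟ c))) (isFree ds c)))))
                     (trans (cong (λ b → 𝟙 b * E d) (Equivalence.to T-≡ free)) (ℕP.*-identityˡ (E d))) ⟩
      ∑[ c < n ] (𝟙 (isFree (d ∷ ds) c) * E c) + E d ∎

    ∑-isFree : ∀ {m} (ds : Vec (Fin n) m) → Distinct ds → ∑[ c < n ] 𝟙 (isFree ds c) ≡ n ∸ m
    ∑-isFree [] _ = trans (∑-const n 1) (ℕP.*-identityʳ n)
    ∑-isFree {suc m} (d ∷ ds) (free , distinct) = begin
      ∑[ c < n ] 𝟙 (isFree (d ∷ ds) c)               ≡⟨ ℕP.m+n∸n≡m _ 1 ⟨
      ∑[ c < n ] 𝟙 (isFree (d ∷ ds) c) + 1 ∸ 1       ≡⟨ cong (_∸ 1) remove-d ⟨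
      ∑[ c < n ] 𝟙 (isFree ds c) ∸ 1                 ≡⟨ cong (_∸ 1) (∑-isFree ds distinct) ⟩
      n ∸ m ∸ 1                                      ≡⟨ ∸-suc n m ⟩
      n ∸ suc m                                      ∎
      where
      pad : ∀ {k} (es : Vec (Fin n) k) → ∑[ c < n ] 𝟙 (isFree es c) ≡ ∑[ c < n ] (𝟙 (isFree es c) * 1)
      pad es = sum-cong-≗ (λ c → sym (ℕP.*-identityʳ (𝟙 (isFree es c))))
      remove-d : ∑[ c < n ] 𝟙 (isFree ds c) ≡ ∑[ c < n ] 𝟙 (isFree (d ∷ ds) c) + 1
      remove-d = trans (pad ds) (trans (∑-isFree-remove ds d (λ _ → 1) free) (cong (_+ 1) (sym (pad (d ∷ ds)))))

    free-column : ∀ {m} (ds : Vec (Fin n) m) → Distinct ds → m < n → ∃ λ c → T (isFree ds c)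
    free-column ds distinct m<n =
      ∑-𝟙-pos (isFree ds) (subst (0 <_) (sym (∑-isFree ds distinct)) (ℕP.m<n⇒0<n∸m m<n))

  -- The library's a P′ k = ∏_{i<k} (a ∸ i) is the falling factorial (a)_k for every k (it is 0 for k > a).
  P′-+ : ∀ a k l → a P′ (k + l) ≡ (a P′ k) * ((a ∸ k) P′ l)
  P′-+ a k zero = trans (cong (a P′_) (ℕP.+-identityʳ k)) (sym (ℕP.*-identityʳ (a P′ k)))
  P′-+ a k (suc l) = begin
    a P′ (k + suc l)                              ≡⟨ cong (a P′_) (ℕP.+-suc k l) ⟩
    (a ∸ (k + l)) * (a P′ (k + l))                ≡⟨ cong₂ _*_ (sym (ℕP.∸-+-assoc a k l)) (P′-+ a k l) ⟩
    (a ∸ k ∸ l) * ((a P′ k) * ((a ∸ k) P′ l))     ≡⟨ ℕP.*-assoc (a ∸ k ∸ l) (a P′ k) _ ⟨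
    (a ∸ k ∸ l) * (a P′ k) * ((a ∸ k) P′ l)       ≡⟨ cong (_* ((a ∸ k) P′ l)) (ℕP.*-comm (a ∸ k ∸ l) _) ⟩
    (a P′ k) * (a ∸ k ∸ l) * ((a ∸ k) P′ l)       ≡⟨ ℕP.*-assoc (a P′ k) _ _ ⟩
    (a P′ k) * ((a ∸ k ∸ l) * ((a ∸ k) P′ l))     ∎

  P′-suc : ∀ a k → a P′ suc k ≡ a * ((a ∸ 1) P′ k)
  P′-suc a k = trans (P′-+ a 1 k) (cong (_* ((a ∸ 1) P′ k)) (ℕP.*-identityʳ a))

  P′-vanishes : ∀ {a k} → a < k → a P′ k ≡ 0
  P′-vanishes {a} {k} a<k = begin
    a P′ k
      ≡⟨ cong (a P′_) (ℕP.m+[n∸m]≡n a<k) ⟨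
    a P′ (suc a + (k ∸ suc a))
      ≡⟨ P′-+ a (suc a) (k ∸ suc a) ⟩
    (a ∸ a) * (a P′ a) * ((a ∸ suc a) P′ (k ∸ suc a))
      ≡⟨ cong (λ z → z * (a P′ a) * ((a ∸ suc a) P′ (k ∸ suc a))) (ℕP.n∸n≡0 a) ⟩
    0 ∎

  P′-∸-suc : ∀ a m k → (a ∸ m) P′ suc k ≡ (a ∸ m) * ((a ∸ suc m) P′ k)
  P′-∸-suc a m k = trans (P′-suc (a ∸ m) k) (cong (λ z → (a ∸ m) * (z P′ k)) (∸-suc a m))

  P′-nonZero : ∀ {a k} → k ≤ a → ℕ.NonZero (a P′ k)
  P′-nonZero {a} {zero}  _   = _
  P′-nonZero {a} {suc k} k<a =
    ℕP.m*n≢0 (a ∸ k) (a P′ k) {{ℕ.>-nonZero (ℕP.m<n⇒0<n∸m k<a)}} {{P′-nonZero (ℕP.<⇒≤ k<a)}}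

  module Moments {n q N : ℕ} (rows : Fin N → Word n q) where

    open Columns {n}

    matches : ∀ {m} → Vec (Fin n) m → Vec (Fin q) m → Word n q → ℕ
    matches cs a y = 𝟙 (does (≡-dec _≟_ (restrict y (lookup cs)) a))

    matches-∷ : ∀ {m} c (cs : Vec (Fin n) m) v a y →
                matches (c ∷ cs) (v ∷ a) y ≡ 𝟙 (does (lookup y c ≟ v)) * matches cs a y
    matches-∷ c cs v a y = 𝟙-∧ (does (lookup y c ≟ v)) _

    count : ∀ {m} → Vec (Fin n) m → Vec (Fin q) m → ℕ
    count cs a = ∑[ r < N ] matches cs a (rows r)

    count-split : ∀ {m} c (cs : Vec (Fin n) m) a → count cs a ≡ ∑[ v < q ] count (c ∷ cs) (v ∷ a)
    count-split c cs a = begin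
      ∑[ r < N ] matches cs a (rows r)
        ≡⟨ sum-cong-≗ (λ r → ∑-δ (lookup (rows r) c) (λ _ → matches cs a (rows r))) ⟨
      ∑[ r < N ] ∑[ v < q ] (𝟙 (does (lookup (rows r) c ≟ v)) * matches cs a (rows r))
        ≡⟨ sum-cong-≗ (λ r → sum-cong-≗ (λ v → matches-∷ c cs v a (rows r))) ⟨
      ∑[ r < N ] ∑[ v < q ] matches (c ∷ cs) (v ∷ a) (rows r)
        ≡⟨ ∑-comm (λ r v → matches (c ∷ cs) (v ∷ a) (rows r)) ⟩
      ∑[ v < q ] count (c ∷ cs) (v ∷ a) ∎

    ∑ᵥ : ∀ m → (Vec (Fin q) m → ℕ) → ℕ
    ∑ᵥ zero    f = f []
    ∑ᵥ (suc m) f = ∑ᵥ m (λ a → ∑[ v < q ] f (v ∷ a))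

    ∑ᵥ-cong : ∀ m {f g : Vec (Fin q) m → ℕ} → (∀ a → f a ≡ g a) → ∑ᵥ m f ≡ ∑ᵥ m g
    ∑ᵥ-cong zero    f≡g = f≡g []
    ∑ᵥ-cong (suc m) f≡g = ∑ᵥ-cong m (λ a → sum-cong-≗ (λ v → f≡g (v ∷ a)))

    ∑ᵥ-const : ∀ m k → ∑ᵥ m (λ _ → k) ≡ q ^ m * k
    ∑ᵥ-const zero    k = sym (ℕP.+-identityʳ k)
    ∑ᵥ-const (suc m) k = begin
      ∑ᵥ m (λ _ → ∑[ v < q ] k)  ≡⟨ ∑ᵥ-cong m (λ _ → ∑-const q k) ⟩
      ∑ᵥ m (λ _ → q * k)         ≡⟨ ∑ᵥ-const m (q * k) ⟩
      q ^ m * (q * k)            ≡⟨ ℕP.*-assoc (q ^ m) q k ⟨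
      q ^ m * q * k              ≡⟨ cong (_* k) (ℕP.*-comm (q ^ m) q) ⟩
      q ^ suc m * k              ∎

    ∑ᵥ-count : ∀ {m} (cs : Vec (Fin n) m) → ∑ᵥ m (count cs) ≡ N
    ∑ᵥ-count []       = trans (∑-const N 1) (ℕP.*-identityʳ N)
    ∑ᵥ-count (c ∷ cs) = trans (∑ᵥ-cong _ (λ a → sym (count-split c cs a))) (∑ᵥ-count cs)

    BalancedAt : ℕ → Set
    BalancedAt m = ∀ (cs : Vec (Fin n) m) → Distinct cs → ∀ a → q ^ m * count cs a ≡ N

    uniform⇒balancedAt : ∀ m → (∀ (cs : Vec (Fin n) m) → Distinct cs → ∀ a b → count cs a ≡ count cs b) →
                         BalancedAt m
    uniform⇒balancedAt m uniform cs distinct a = begin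
      q ^ m * count cs a          ≡⟨ ∑ᵥ-const m (count cs a) ⟨
      ∑ᵥ m (λ _ → count cs a)     ≡⟨ ∑ᵥ-cong m (λ b → uniform cs distinct a b) ⟩
      ∑ᵥ m (count cs)             ≡⟨ ∑ᵥ-count cs ⟩
      N                           ∎

    balancedAt-pred : ∀ {m} .{{_ : ℕ.NonZero q}} → suc m ≤ n → BalancedAt (suc m) → BalancedAt m
    balancedAt-pred {m} m<n balanced cs distinct a with free-column cs distinct m<n
    ... | c , free = ℕP.*-cancelˡ-≡ _ _ q (begin
      q * (q ^ m * count cs a)
        ≡⟨ ℕP.*-assoc q (q ^ m) _ ⟨
      q ^ suc m * count cs a
        ≡⟨ cong (q ^ suc m *_) (count-split c cs a) ⟩
      q ^ suc m * ∑[ v < q ] count (c ∷ cs) (v ∷ a)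
        ≡⟨ *-distribˡ-sum (q ^ suc m) (λ v → count (c ∷ cs) (v ∷ a)) ⟩
      ∑[ v < q ] (q ^ suc m * count (c ∷ cs) (v ∷ a))
        ≡⟨ sum-cong-≗ (λ v → balanced (c ∷ cs) (free , distinct) (v ∷ a)) ⟩
      ∑[ v < q ] N
        ≡⟨ ∑-const q N ⟩
      q * N ∎)

    Balanced : ℕ → Set
    Balanced t = ∀ {m} → m ≤ t → BalancedAt m

    balancedAt⇒balanced : ∀ {t} .{{_ : ℕ.NonZero q}} → t ≤ n → BalancedAt t → Balanced t
    balancedAt⇒balanced {t} t≤n balanced {m} m≤t =
      descend (t ∸ m) (subst BalancedAt (sym (ℕP.m∸n+n≡m m≤t)) balanced)
              (subst (_≤ n) (sym (ℕP.m∸n+n≡m m≤t)) t≤n)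
      where
      descend : ∀ k {m} → BalancedAt (k + m) → k + m ≤ n → BalancedAt m
      descend zero    b _ = b
      descend (suc k) {m} b k+m<n =
        balancedAt-pred (ℕP.≤-trans (ℕP.m≤n+m (suc m) k) le) (descend k (subst BalancedAt eq b) le)
        where
        eq : suc k + m ≡ k + suc m
        eq = sym (ℕP.+-suc k m)
        le : k + suc m ≤ n
        le = subst (_≤ n) eq k+m<n

    module _ (x : Word n q) where

      agrees : Fin n → Fin q → Bool
      agrees c v = does (lookup x c ≟ v)

      agreements disagreements : ∀ {m} → Vec (Fin n) m → Word n q → ℕ
      agreements    cs y = ∑[ c < n ] (𝟙 (isFree cs c) * 𝟙 (agrees c (lookup y c)))
      disagreements cs y = ∑[ c < n ] (𝟙 (isFree cs c) * 𝟙 (not (agrees c (lookup y c))))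

      -- If y has the values a on the columns cs, this counts the sequences of i + ℓ distinct columns
      -- outside cs on whose first i entries y agrees with x and on whose last ℓ entries it does not.
      choices : ∀ {m} → Vec (Fin n) m → Vec (Fin q) m → ℕ → ℕ → Word n q → ℕ
      choices cs a i ℓ y = matches cs a y * ((agreements cs y P′ i) * (disagreements cs y P′ ℓ))

      choices-update : ∀ {m} (cs : Vec (Fin n) m) c y b i ℓ → T (isFree cs c) → agrees c (lookup y c) ≡ b →
        ((agreements cs y ∸ 𝟙 b) P′ i) * ((disagreements cs y ∸ 𝟙 (not b)) P′ ℓ) ≡
        (agreements (c ∷ cs) y P′ i) * (disagreements (c ∷ cs) y P′ ℓ)
      choices-update cs c y b i ℓ free refl =
        cong₂ (λ u w → (u P′ i) * (w P′ ℓ)) (peel (λ c′ → 𝟙 (agrees c′ (lookup y c′))))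
                                            (peel (λ c′ → 𝟙 (not (agrees c′ (lookup y c′)))))
        where
        peel : (E : Fin n → ℕ) →
               ∑[ c′ < n ] (𝟙 (isFree cs c′) * E c′) ∸ E c ≡ ∑[ c′ < n ] (𝟙 (isFree (c ∷ cs) c′) * E c′)
        peel E = trans (cong (_∸ E c) (∑-isFree-remove cs c E free)) (ℕP.m+n∸n≡m _ (E c))

      choices-suc-agreements : ∀ {m} (cs : Vec (Fin n) m) a i ℓ y →
        choices cs a (suc i) ℓ y ≡ ∑[ c < n ] (𝟙 (isFree cs c) * choices (c ∷ cs) (lookup x c ∷ a) i ℓ y)
      choices-suc-agreements cs a i ℓ y = begin
        M * ((A P′ suc i) * (D P′ ℓ))
          ≡⟨ cong (λ z → M * (z * (D P′ ℓ))) (P′-suc A i) ⟩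
        M * (A * ((A ∸ 1) P′ i) * (D P′ ℓ))
          ≡⟨ shuffle M A ((A ∸ 1) P′ i) (D P′ ℓ) ⟩
        A * (M * X)
          ≡⟨ *-distribʳ-sum (M * X) (λ c → 𝟙 (isFree cs c) * 𝟙 (agrees c (lookup y c))) ⟩
        ∑[ c < n ] (𝟙 (isFree cs c) * 𝟙 (agrees c (lookup y c)) * (M * X))
          ≡⟨ sum-cong-≗ column ⟩
        ∑[ c < n ] (𝟙 (isFree cs c) * choices (c ∷ cs) (lookup x c ∷ a) i ℓ y) ∎
        where
        M = matches cs a y
        A = agreements cs y
        D = disagreements cs y
        X = ((A ∸ 1) P′ i) * (D P′ ℓ)
        shuffle : ∀ m a b d → m * (a * b * d) ≡ a * (m * (b * d))
        shuffle = solve-∀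
        column : ∀ c → 𝟙 (isFree cs c) * 𝟙 (agrees c (lookup y c)) * (M * X) ≡
                       𝟙 (isFree cs c) * choices (c ∷ cs) (lookup x c ∷ a) i ℓ y
        column c = begin
          𝟙 (isFree cs c) * 𝟙 (agrees c (lookup y c)) * (M * X)
            ≡⟨ ℕP.*-assoc (𝟙 (isFree cs c)) _ _ ⟩
          𝟙 (isFree cs c) * (𝟙 (agrees c (lookup y c)) * (M * X))
            ≡⟨ 𝟙*-cong (isFree cs c) (λ free → 𝟙*-cong (agrees c (lookup y c)) (λ agree →
                 cong (M *_) (choices-update cs c y true i ℓ free (Equivalence.to T-≡ agree)))) ⟩
          𝟙 (isFree cs c) * (𝟙 (agrees c (lookup y c)) * (M * X′))
            ≡⟨ cong (𝟙 (isFree cs c) *_) (trans (sym (ℕP.*-assoc (𝟙 (agrees c (lookup y c))) M X′))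
                                                (cong (λ b → 𝟙 b * M * X′) (≟-does-sym (lookup x c) (lookup y c)))) ⟩
          𝟙 (isFree cs c) * (𝟙 (does (lookup y c ≟ lookup x c)) * M * X′)
            ≡⟨ cong (λ z → 𝟙 (isFree cs c) * (z * X′)) (matches-∷ c cs (lookup x c) a y) ⟨
          𝟙 (isFree cs c) * choices (c ∷ cs) (lookup x c ∷ a) i ℓ y ∎
          where X′ = (agreements (c ∷ cs) y P′ i) * (disagreements (c ∷ cs) y P′ ℓ)

      choices-suc-disagreements : ∀ {m} (cs : Vec (Fin n) m) a i ℓ y →
        choices cs a i (suc ℓ) y ≡
        ∑[ c < n ] (𝟙 (isFree cs c) * ∑[ v < q ] (𝟙 (not (agrees c v)) * choices (c ∷ cs) (v ∷ a) i ℓ y))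
      choices-suc-disagreements cs a i ℓ y = begin
        M * ((A P′ i) * (D P′ suc ℓ))
          ≡⟨ cong (λ z → M * ((A P′ i) * z)) (P′-suc D ℓ) ⟩
        M * ((A P′ i) * (D * ((D ∸ 1) P′ ℓ)))
          ≡⟨ shuffle M (A P′ i) D ((D ∸ 1) P′ ℓ) ⟩
        D * (M * X)
          ≡⟨ *-distribʳ-sum (M * X) (λ c → 𝟙 (isFree cs c) * 𝟙 (not (agrees c (lookup y c)))) ⟩
        ∑[ c < n ] (𝟙 (isFree cs c) * 𝟙 (not (agrees c (lookup y c))) * (M * X))
          ≡⟨ sum-cong-≗ column ⟩
        ∑[ c < n ] (𝟙 (isFree cs c) * ∑[ v < q ] (𝟙 (not (agrees c v)) * choices (c ∷ cs) (v ∷ a) i ℓ y)) ∎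
        where
        M = matches cs a y
        A = agreements cs y
        D = disagreements cs y
        X = (A P′ i) * ((D ∸ 1) P′ ℓ)
        shuffle : ∀ m b d e → m * (b * (d * e)) ≡ d * (m * (b * e))
        shuffle = solve-∀
        swap : ∀ u w m z → u * (w * (m * z)) ≡ w * (u * m * z)
        swap = solve-∀
        column : ∀ c → 𝟙 (isFree cs c) * 𝟙 (not (agrees c (lookup y c))) * (M * X) ≡
                       𝟙 (isFree cs c) * ∑[ v < q ] (𝟙 (not (agrees c v)) * choices (c ∷ cs) (v ∷ a) i ℓ y)
        column c = begin
          𝟙 (isFree cs c) * 𝟙 (not (agrees c (lookup y c))) * (M * X)
            ≡⟨ ℕP.*-assoc (𝟙 (isFree cs c)) _ _ ⟩
          𝟙 (isFree cs c) * (𝟙 (not (agrees c (lookup y c))) * (M * X))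
            ≡⟨ cong (𝟙 (isFree cs c) *_) (∑-δ (lookup y c) (λ v → 𝟙 (not (agrees c v)) * (M * X))) ⟨
          𝟙 (isFree cs c) * ∑[ v < q ] (𝟙 (does (lookup y c ≟ v)) * (𝟙 (not (agrees c v)) * (M * X)))
            ≡⟨ 𝟙*-cong (isFree cs c) (λ free → sum-cong-≗ (value free)) ⟩
          𝟙 (isFree cs c) * ∑[ v < q ] (𝟙 (not (agrees c v)) * choices (c ∷ cs) (v ∷ a) i ℓ y) ∎
          where
          X′ = (agreements (c ∷ cs) y P′ i) * (disagreements (c ∷ cs) y P′ ℓ)
          value : T (isFree cs c) → ∀ v →
                  𝟙 (does (lookup y c ≟ v)) * (𝟙 (not (agrees c v)) * (M * X)) ≡
                  𝟙 (not (agrees c v)) * choices (c ∷ cs) (v ∷ a) i ℓ y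
          value free v = begin
            𝟙 (does (lookup y c ≟ v)) * (𝟙 (not (agrees c v)) * (M * X))
              ≡⟨ 𝟙*-cong (does (lookup y c ≟ v)) (λ yc≡v → 𝟙*-cong (not (agrees c v)) (λ v≢xc →
                   cong (M *_) (choices-update cs c y false i ℓ free
                     (trans (cong (λ u → agrees c u) (T-does (lookup y c ≟ v) yc≡v)) (Equivalence.to T-not-≡ v≢xc))))) ⟩
            𝟙 (does (lookup y c ≟ v)) * (𝟙 (not (agrees c v)) * (M * X′))
              ≡⟨ swap (𝟙 (does (lookup y c ≟ v))) (𝟙 (not (agrees c v))) M X′ ⟩
            𝟙 (not (agrees c v)) * (𝟙 (does (lookup y c ≟ v)) * M * X′)
              ≡⟨ cong (λ z → 𝟙 (not (agrees c v)) * (z * X′)) (matches-∷ c cs v a y) ⟨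
            𝟙 (not (agrees c v)) * choices (c ∷ cs) (v ∷ a) i ℓ y ∎

      moment : ∀ {m} → Vec (Fin n) m → Vec (Fin q) m → ℕ → ℕ → ℕ
      moment cs a i ℓ = ∑[ r < N ] choices cs a i ℓ (rows r)

      moment-suc-agreements : ∀ {m} (cs : Vec (Fin n) m) a i ℓ →
        moment cs a (suc i) ℓ ≡ ∑[ c < n ] (𝟙 (isFree cs c) * moment (c ∷ cs) (lookup x c ∷ a) i ℓ)
      moment-suc-agreements cs a i ℓ =
        trans (sum-cong-≗ (λ r → choices-suc-agreements cs a i ℓ (rows r)))
              (∑-comm-*ˡ (𝟙 ∘ isFree cs) (λ c r → choices (c ∷ cs) (lookup x c ∷ a) i ℓ (rows r)))

      moment-suc-disagreements : ∀ {m} (cs : Vec (Fin n) m) a i ℓ →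
        moment cs a i (suc ℓ) ≡
        ∑[ c < n ] (𝟙 (isFree cs c) * ∑[ v < q ] (𝟙 (not (agrees c v)) * moment (c ∷ cs) (v ∷ a) i ℓ))
      moment-suc-disagreements cs a i ℓ =
        trans (sum-cong-≗ (λ r → choices-suc-disagreements cs a i ℓ (rows r)))
        (trans (∑-comm-*ˡ (𝟙 ∘ isFree cs)
                          (λ c r → ∑[ v < q ] (𝟙 (not (agrees c v)) * choices (c ∷ cs) (v ∷ a) i ℓ (rows r))))
               (sum-cong-≗ (λ c → cong (𝟙 (isFree cs c) *_)
                 (∑-comm-*ˡ (λ v → 𝟙 (not (agrees c v))) (λ v r → choices (c ∷ cs) (v ∷ a) i ℓ (rows r))))))

      moment-formula : ∀ {t} → Balanced t → ∀ {m} (cs : Vec (Fin n) m) → Distinct cs → ∀ a i ℓ → m + (i + ℓ) ≤ t →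
        q ^ (m + (i + ℓ)) * moment cs a i ℓ ≡ N * (((n ∸ m) P′ (i + ℓ)) * (q ∸ 1) ^ ℓ)
      moment-formula {t} balanced {m} cs distinct a zero zero bound = begin
        q ^ (m + 0) * moment cs a 0 0
          ≡⟨ cong₂ (λ e z → q ^ e * z) (ℕP.+-identityʳ m)
                   (sum-cong-≗ (λ r → ℕP.*-identityʳ (matches cs a (rows r)))) ⟩
        q ^ m * count cs a
          ≡⟨ balanced (subst (_≤ t) (ℕP.+-identityʳ m) bound) cs distinct a ⟩
        N
          ≡⟨ ℕP.*-identityʳ N ⟨
        N * 1 ∎
      moment-formula {t} balanced {m} cs distinct a (suc i) ℓ bound = begin
        q ^ (m + suc (i + ℓ)) * moment cs a (suc i) ℓ
          ≡⟨ cong (q ^ (m + suc (i + ℓ)) *_) (moment-suc-agreements cs a i ℓ) ⟩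
        q ^ (m + suc (i + ℓ)) * ∑[ c < n ] (𝟙 (isFree cs c) * moment (c ∷ cs) (lookup x c ∷ a) i ℓ)
          ≡⟨ ∑-𝟙*-scaled (isFree cs) (λ c → moment (c ∷ cs) (lookup x c ∷ a) i ℓ) (q ^ (m + suc (i + ℓ))) K
               (λ c free →
               trans (cong (λ e → q ^ e * moment (c ∷ cs) (lookup x c ∷ a) i ℓ) (ℕP.+-suc m (i + ℓ)))
                     (moment-formula balanced (c ∷ cs) (free , distinct) (lookup x c ∷ a) i ℓ bound′)) ⟩
        ∑[ c < n ] 𝟙 (isFree cs c) * K
          ≡⟨ cong (_* K) (∑-isFree cs distinct) ⟩
        (n ∸ m) * K
          ≡⟨ shuffle (n ∸ m) N _ _ ⟩
        N * ((n ∸ m) * ((n ∸ suc m) P′ (i + ℓ)) * (q ∸ 1) ^ ℓ)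
          ≡⟨ cong (λ z → N * (z * (q ∸ 1) ^ ℓ)) (P′-∸-suc n m (i + ℓ)) ⟨
        N * (((n ∸ m) P′ suc (i + ℓ)) * (q ∸ 1) ^ ℓ) ∎
        where
        K = N * (((n ∸ suc m) P′ (i + ℓ)) * (q ∸ 1) ^ ℓ)
        bound′ : suc m + (i + ℓ) ≤ t
        bound′ = subst (_≤ t) (ℕP.+-suc m (i + ℓ)) bound
        shuffle : ∀ a N b p → a * (N * (b * p)) ≡ N * (a * b * p)
        shuffle = solve-∀
      moment-formula {t} balanced {m} cs distinct a zero (suc ℓ) bound = begin
        q ^ (m + suc ℓ) * moment cs a 0 (suc ℓ)
          ≡⟨ cong (q ^ (m + suc ℓ) *_) (moment-suc-disagreements cs a 0 ℓ) ⟩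
        q ^ (m + suc ℓ) * ∑[ c < n ] (𝟙 (isFree cs c) * ∑[ v < q ] (𝟙 (not (agrees c v)) * moment (c ∷ cs) (v ∷ a) 0 ℓ))
          ≡⟨ ∑-𝟙*-scaled (isFree cs) (λ c → ∑[ v < q ] (𝟙 (not (agrees c v)) * moment (c ∷ cs) (v ∷ a) 0 ℓ))
                          (q ^ (m + suc ℓ)) ((q ∸ 1) * K) column ⟩
        ∑[ c < n ] 𝟙 (isFree cs c) * ((q ∸ 1) * K)
          ≡⟨ cong (_* ((q ∸ 1) * K)) (∑-isFree cs distinct) ⟩
        (n ∸ m) * ((q ∸ 1) * K)
          ≡⟨ shuffle (n ∸ m) (q ∸ 1) N _ _ ⟩
        N * ((n ∸ m) * ((n ∸ suc m) P′ ℓ) * (q ∸ 1) ^ suc ℓ)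
          ≡⟨ cong (λ z → N * (z * (q ∸ 1) ^ suc ℓ)) (P′-∸-suc n m ℓ) ⟨
        N * (((n ∸ m) P′ suc ℓ) * (q ∸ 1) ^ suc ℓ) ∎
        where
        K = N * (((n ∸ suc m) P′ ℓ) * (q ∸ 1) ^ ℓ)
        bound′ : suc m + ℓ ≤ t
        bound′ = subst (_≤ t) (ℕP.+-suc m ℓ) bound
        shuffle : ∀ a r N b p → a * (r * (N * (b * p))) ≡ N * (a * b * (r * p))
        shuffle = solve-∀
        column : ∀ c → T (isFree cs c) →
                 q ^ (m + suc ℓ) * ∑[ v < q ] (𝟙 (not (agrees c v)) * moment (c ∷ cs) (v ∷ a) 0 ℓ) ≡ (q ∸ 1) * K
        column c free = trans
          (∑-𝟙*-scaled (λ v → not (agrees c v)) (λ v → moment (c ∷ cs) (v ∷ a) 0 ℓ) (q ^ (m + suc ℓ)) K (λ v _ →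
             trans (cong (λ e → q ^ e * moment (c ∷ cs) (v ∷ a) 0 ℓ) (ℕP.+-suc m ℓ))
                   (moment-formula balanced (c ∷ cs) (free , distinct) (v ∷ a) 0 ℓ bound′)))
          (cong (_* K) (∑-𝟙-≢ (lookup x c)))

      disagreements-[] : ∀ y → disagreements [] y ≡ ham x y
      disagreements-[] y = begin
        ∑[ c < n ] (1 * 𝟙 (not (agrees c (lookup y c))))
          ≡⟨ sum-cong-≗ (λ c → ℕP.*-identityˡ (𝟙 (not (agrees c (lookup y c))))) ⟩
        ∑[ c < n ] 𝟙 (not (does (lookup x c ≟ lookup y c)))
          ≡⟨ length-filter-tabulate (λ c → ¬? (lookup x c ≟ lookup y c)) (λ c → c) ⟨
        ham x y ∎

      agreements-[] : ∀ y → agreements [] y ≡ n ∸ ham x y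
      agreements-[] y = begin
        agreements [] y                                        ≡⟨ ℕP.m+n∸n≡m _ (disagreements [] y) ⟨
        agreements [] y + disagreements [] y ∸ disagreements [] y ≡⟨ cong₂ _∸_ total (disagreements-[] y) ⟩
        n ∸ ham x y                                            ∎
        where
        total : agreements [] y + disagreements [] y ≡ n
        total = begin
          agreements [] y + disagreements [] y
            ≡⟨ ∑-distrib-+ (λ c → 1 * 𝟙 (agrees c (lookup y c))) (λ c → 1 * 𝟙 (not (agrees c (lookup y c)))) ⟨
          ∑[ c < n ] (1 * 𝟙 (agrees c (lookup y c)) + 1 * 𝟙 (not (agrees c (lookup y c))))
            ≡⟨ sum-cong-≗ (λ c → complement (agrees c (lookup y c))) ⟩
          ∑[ c < n ] 1
            ≡⟨ trans (∑-const n 1) (ℕP.*-identityʳ n) ⟩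
          n ∎
          where
          complement : ∀ b → 1 * 𝟙 b + 1 * 𝟙 (not b) ≡ 1
          complement false = refl
          complement true  = refl

      moment-formula-ham : ∀ {t} → Balanced t → ∀ i ℓ → i + ℓ ≤ t →
        q ^ (i + ℓ) * ∑[ r < N ] (((n ∸ ham x (rows r)) P′ i) * (ham x (rows r) P′ ℓ)) ≡
        N * ((n P′ (i + ℓ)) * (q ∸ 1) ^ ℓ)
      moment-formula-ham balanced i ℓ bound =
        trans (cong (q ^ (i + ℓ) *_) (sum-cong-≗ λ r → begin
                 ((n ∸ ham x (rows r)) P′ i) * (ham x (rows r) P′ ℓ)
                   ≡⟨ cong₂ (λ u w → (u P′ i) * (w P′ ℓ)) (agreements-[] (rows r)) (disagreements-[] (rows r)) ⟨
                 (agreements [] (rows r) P′ i) * (disagreements [] (rows r) P′ ℓ)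
                   ≡⟨ ℕP.*-identityˡ _ ⟨
                 choices [] [] i ℓ (rows r) ∎))
              (moment-formula balanced [] tt [] i ℓ bound)

  module _ {n q : ℕ} (C : List (Word n q)) where

    open Columns {n}
    open Moments (List.lookup C)

    design⇒balanced : ∀ {t} .{{_ : ℕ.NonZero q}} → t ≤ n → IsDesign t C → Balanced t
    design⇒balanced {t} t≤n design = balancedAt⇒balanced t≤n (uniform⇒balancedAt t uniform)
      where
      count≡countPattern : ∀ (cs : Vec (Fin n) t) a → count cs a ≡ countPattern C (lookup cs) a
      count≡countPattern cs a =
        trans (sym (length-filter-tabulate (λ y → ≡-dec _≟_ (restrict y (lookup cs)) a) (List.lookup C)))
              (cong (λ D → length (filter (λ y → ≡-dec _≟_ (restrict y (lookup cs)) a) D)) (ListP.tabulate-lookup C))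
      uniform : ∀ (cs : Vec (Fin n) t) → Distinct cs → ∀ a b → count cs a ≡ count cs b
      uniform cs distinct a b =
        trans (count≡countPattern cs a)
              (trans (design (lookup cs) (Distinct⇒lookup-injective cs distinct) a b) (sym (count≡countPattern cs b)))

module Rational where

  open import Data.Rational as ℚ using (ℚ; 0ℚ; 1ℚ; _+_; _*_; _-_; -_; toℚᵘ)
  open Counting using (P′-vanishes)
  open import Algebra.Properties.Semiring.Sum (CommutativeRing.semiring ℚP.+-*-commutativeRing)
  import Algebra.Properties.Semiring.Sum ℕP.+-*-semiring as ℕΣ
  open import Algebra.Properties.CommutativeSemigroup (CommutativeMonoid.commutativeSemigroup ℚP.+-0-commutativeMonoid)
    using (interchange)

  module _ where

    open ℚᵘP.≃-Reasoning

    toℚᵘ-fromℕ : ∀ m → toℚᵘ (fromℕ m) ℚᵘ.≃ ℚᵘ.mkℚᵘ (ℤ.+ m) 0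
    toℚᵘ-fromℕ m = ℚP.toℚᵘ-fromℚᵘ (ℚᵘ.mkℚᵘ (ℤ.+ m) 0)

    fromℕ-+ : ∀ a b → fromℕ (a ℕ.+ b) ≡ fromℕ a + fromℕ b
    fromℕ-+ a b = ℚP.toℚᵘ-injective (begin
      toℚᵘ (fromℕ (a ℕ.+ b))
        ≈⟨ toℚᵘ-fromℕ (a ℕ.+ b) ⟩
      ℚᵘ.mkℚᵘ (ℤ.+ (a ℕ.+ b)) 0
        ≈⟨ ℚᵘ.*≡* (cong (ℤ._* ℤ.+ 1) (trans (ℤP.pos-+ a b)
                     (sym (cong₂ ℤ._+_ (ℤP.*-identityʳ (ℤ.+ a)) (ℤP.*-identityʳ (ℤ.+ b)))))) ⟩
      ℚᵘ.mkℚᵘ (ℤ.+ a) 0 ℚᵘ.+ ℚᵘ.mkℚᵘ (ℤ.+ b) 0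
        ≈⟨ ℚᵘP.+-cong (toℚᵘ-fromℕ a) (toℚᵘ-fromℕ b) ⟨
      toℚᵘ (fromℕ a) ℚᵘ.+ toℚᵘ (fromℕ b)
        ≈⟨ ℚP.toℚᵘ-homo-+ (fromℕ a) (fromℕ b) ⟨
      toℚᵘ (fromℕ a + fromℕ b) ∎)

    fromℕ-* : ∀ a b → fromℕ (a ℕ.* b) ≡ fromℕ a * fromℕ b
    fromℕ-* a b = ℚP.toℚᵘ-injective (begin
      toℚᵘ (fromℕ (a ℕ.* b))
        ≈⟨ toℚᵘ-fromℕ (a ℕ.* b) ⟩
      ℚᵘ.mkℚᵘ (ℤ.+ (a ℕ.* b)) 0
        ≈⟨ ℚᵘ.*≡* (cong (ℤ._* ℤ.+ 1) (ℤP.pos-* a b)) ⟩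
      ℚᵘ.mkℚᵘ (ℤ.+ a) 0 ℚᵘ.* ℚᵘ.mkℚᵘ (ℤ.+ b) 0
        ≈⟨ ℚᵘP.*-cong (toℚᵘ-fromℕ a) (toℚᵘ-fromℕ b) ⟨
      toℚᵘ (fromℕ a) ℚᵘ.* toℚᵘ (fromℕ b)
        ≈⟨ ℚP.toℚᵘ-homo-* (fromℕ a) (fromℕ b) ⟨
      toℚᵘ (fromℕ a * fromℕ b) ∎)

    frac-* : ∀ N d X Y .{{_ : ℕ.NonZero d}} → d ℕ.* Y ≡ N ℕ.* X → frac N d * fromℕ X ≡ fromℕ Y
    frac-* N (suc d) X Y dY≡NX = ℚP.toℚᵘ-injective (begin
      toℚᵘ (frac N (suc d) * fromℕ X)
        ≈⟨ ℚP.toℚᵘ-homo-* (frac N (suc d)) (fromℕ X) ⟩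
      toℚᵘ (frac N (suc d)) ℚᵘ.* toℚᵘ (fromℕ X)
        ≈⟨ ℚᵘP.*-cong (ℚP.toℚᵘ-fromℚᵘ (ℚᵘ.mkℚᵘ (ℤ.+ N) d)) (toℚᵘ-fromℕ X) ⟩
      ℚᵘ.mkℚᵘ (ℤ.+ N) d ℚᵘ.* ℚᵘ.mkℚᵘ (ℤ.+ X) 0
        ≈⟨ ℚᵘ.*≡* cross ⟩
      ℚᵘ.mkℚᵘ (ℤ.+ Y) 0
        ≈⟨ toℚᵘ-fromℕ Y ⟨
      toℚᵘ (fromℕ Y) ∎)
      where
      cross : (ℤ.+ N ℤ.* ℤ.+ X) ℤ.* ℤ.+ 1 ≡ ℤ.+ Y ℤ.* ℤ.+ (suc d ℕ.* 1)
      cross = trans (ℤP.*-identityʳ _) (trans (sym (ℤP.pos-* N X)) (trans (cong ℤ.+_ NX≡Yd) (ℤP.pos-* Y (suc d ℕ.* 1))))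
        where
        NX≡Yd : N ℕ.* X ≡ Y ℕ.* (suc d ℕ.* 1)
        NX≡Yd = trans (sym dY≡NX) (trans (ℕP.*-comm (suc d) Y) (cong (Y ℕ.*_) (sym (ℕP.*-identityʳ (suc d)))))

  open ≡-Reasoning

  fromℕ-∸ : ∀ {a b} → b ≤ a → fromℕ (a ∸ b) ≡ fromℕ a - fromℕ b
  fromℕ-∸ {a} {b} b≤a = begin
    fromℕ (a ∸ b)                         ≡⟨ ℚP.+-identityʳ _ ⟨
    fromℕ (a ∸ b) + 0ℚ                    ≡⟨ cong (fromℕ (a ∸ b) +_) (ℚP.+-inverseʳ (fromℕ b)) ⟨
    fromℕ (a ∸ b) + (fromℕ b - fromℕ b)   ≡⟨ ℚP.+-assoc (fromℕ (a ∸ b)) (fromℕ b) _ ⟨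
    fromℕ (a ∸ b) + fromℕ b - fromℕ b     ≡⟨ cong (_- fromℕ b) (fromℕ-+ (a ∸ b) b) ⟨
    fromℕ (a ∸ b ℕ.+ b) - fromℕ b         ≡⟨ cong (λ c → fromℕ c - fromℕ b) (ℕP.m∸n+n≡m b≤a) ⟩
    fromℕ a - fromℕ b                     ∎

  *-fromℕ-cancelʳ : ∀ p k .{{_ : ℕ.NonZero k}} → p * fromℕ k ≡ 0ℚ → p ≡ 0ℚ
  *-fromℕ-cancelʳ p (suc k) pr≡0 = begin
    p                      ≡⟨ ℚP.*-identityʳ p ⟨
    p * 1ℚ                 ≡⟨ cong (p *_) (ℚP.*-inverseʳ r) ⟨
    p * (r * ℚ.1/ r)       ≡⟨ ℚP.*-assoc p r (ℚ.1/ r) ⟨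
    p * r * ℚ.1/ r         ≡⟨ cong (_* ℚ.1/ r) pr≡0 ⟩
    0ℚ * ℚ.1/ r            ≡⟨ ℚP.*-zeroˡ (ℚ.1/ r) ⟩
    0ℚ                     ∎
    where
    r = fromℕ (suc k)
    instance
      r≢0 : ℚ.NonZero r
      r≢0 = ℚP.pos⇒nonZero r {{ℚP.normalize-pos (suc k) 1}}

  ff-fromℕ : ∀ a k → ff (fromℕ a) k ≡ fromℕ (a P′ k)
  ff-fromℕ a zero = refl
  ff-fromℕ a (suc k) with k ℕP.≤? a
  ... | yes k≤a = begin
    ff (fromℕ a) k * (fromℕ a - fromℕ k)     ≡⟨ cong₂ _*_ (ff-fromℕ a k) (sym (fromℕ-∸ k≤a)) ⟩
    fromℕ (a P′ k) * fromℕ (a ∸ k)           ≡⟨ ℚP.*-comm (fromℕ (a P′ k)) (fromℕ (a ∸ k)) ⟩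
    fromℕ (a ∸ k) * fromℕ (a P′ k)           ≡⟨ fromℕ-* (a ∸ k) (a P′ k) ⟨
    fromℕ ((a ∸ k) ℕ.* (a P′ k))             ∎
  ... | no k≰a = begin
    ff (fromℕ a) k * (fromℕ a - fromℕ k)
      ≡⟨ cong (_* (fromℕ a - fromℕ k)) (trans (ff-fromℕ a k) (cong fromℕ (P′-vanishes (ℕP.≰⇒> k≰a)))) ⟩
    0ℚ * (fromℕ a - fromℕ k)                 ≡⟨ ℚP.*-zeroˡ (fromℕ a - fromℕ k) ⟩
    0ℚ                                       ≡⟨ cong fromℕ (P′-vanishes (ℕP.≤-trans (ℕP.≰⇒> k≰a) (ℕP.n≤1+n k))) ⟨
    fromℕ (a P′ suc k)                       ∎

  sumTo-cong : ∀ m {f g : ℕ → ℚ} → (∀ j → j ≤ m → f j ≡ g j) → sumTo m f ≡ sumTo m g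
  sumTo-cong zero    f≡g = f≡g 0 ℕ.z≤n
  sumTo-cong (suc m) f≡g = cong₂ _+_ (sumTo-cong m (λ j j≤m → f≡g j (ℕP.m≤n⇒m≤1+n j≤m))) (f≡g (suc m) ℕP.≤-refl)

  sumTo-+ : ∀ m (f g : ℕ → ℚ) → sumTo m (λ j → f j + g j) ≡ sumTo m f + sumTo m g
  sumTo-+ zero    f g = refl
  sumTo-+ (suc m) f g = trans (cong (_+ (f (suc m) + g (suc m))) (sumTo-+ m f g))
                              (interchange (sumTo m f) (sumTo m g) (f (suc m)) (g (suc m)))

  sumTo-shift : ∀ m (f : ℕ → ℚ) → sumTo (suc m) f ≡ f 0 + sumTo m (f ∘ suc)
  sumTo-shift zero    f = refl
  sumTo-shift (suc m) f = trans (cong (_+ f (suc (suc m))) (sumTo-shift m f)) (ℚP.+-assoc (f 0) _ _)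

  sumTo-*ʳ : ∀ m (f : ℕ → ℚ) c → sumTo m f * c ≡ sumTo m (λ j → f j * c)
  sumTo-*ʳ zero    f c = refl
  sumTo-*ʳ (suc m) f c = trans (ℚP.*-distribʳ-+ c (sumTo m f) (f (suc m))) (cong (_+ f (suc m) * c) (sumTo-*ʳ m f c))

  F-above : ∀ X k → F X k (suc k) ≡ 0ℚ
  F-above X zero = refl
  F-above X (suc k) with suc k ℕ.≟ k
  ... | yes k+1≡k = ⊥-elim (ℕP.1+n≢n k+1≡k)
  ... | no _ with suc k ℕ.<? k
  ...   | yes k+1<k = ⊥-elim (ℕP.n≮n k (ℕP.<-trans (ℕP.n<1+n k) k+1<k))
  ...   | no _ = refl

  F-diag : ∀ X k → F X k k ≡ prodFrom1 k X
  F-diag X zero = refl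
  F-diag X (suc k) with k ℕ.≟ k
  ... | yes _ = refl
  ... | no k≢k = ⊥-elim (k≢k refl)

  F-suc : ∀ X k j → j ≤ k →
          F X (suc k) (suc j) ≡ F X k (suc j) + (X (suc k) - fromℕ (suc k) + fromℕ (suc j)) * F X k j
  F-suc X k j j≤k with j ℕ.≟ k
  ... | yes refl = begin
    prodFrom1 (suc j) X                               ≡⟨ top (prodFrom1 j X) (X (suc j)) (fromℕ (suc j)) ⟩
    0ℚ + (X (suc j) - fromℕ (suc j) + fromℕ (suc j)) * prodFrom1 j X
      ≡⟨ cong₂ (λ u w → u + (X (suc j) - fromℕ (suc j) + fromℕ (suc j)) * w) (F-above X j) (F-diag X j) ⟨
    F X j (suc j) + (X (suc j) - fromℕ (suc j) + fromℕ (suc j)) * F X j j ∎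
    where
    top : ∀ p x a → p * x ≡ 0ℚ + (x - a + a) * p
    top = solve 3 (λ p x a → p :* x := con 0ℚ :+ (x :- a :+ a) :* p) refl
  ... | no j≢k with j ℕ.<? k
  ...   | yes _ = refl
  ...   | no j≮k = ⊥-elim (j≮k (ℕP.≤∧≢⇒< j≤k j≢k))

  sumTo-F : ∀ X m z → sumTo m (λ j → sign j * ff z (m ∸ j) * F X m j) ≡ P X m z
  sumTo-F X zero    z = refl
  sumTo-F X (suc m) z = begin
    sumTo (suc m) L                                  ≡⟨ sumTo-shift m L ⟩
    U 0 + sumTo m (L ∘ suc)                          ≡⟨ cong (U 0 +_) (sumTo-cong m L-suc) ⟩
    U 0 + sumTo m (λ j → U (suc j) + V j)            ≡⟨ cong (U 0 +_) (sumTo-+ m (U ∘ suc) V) ⟩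
    U 0 + (sumTo m (U ∘ suc) + sumTo m V)            ≡⟨ ℚP.+-assoc (U 0) _ _ ⟨
    U 0 + sumTo m (U ∘ suc) + sumTo m V              ≡⟨ cong (_+ sumTo m V) (sumTo-shift m U) ⟨
    sumTo m U + U (suc m) + sumTo m V                ≡⟨ cong (λ u → sumTo m U + u + sumTo m V) U-top ⟩
    sumTo m U + 0ℚ + sumTo m V                       ≡⟨ cong (_+ sumTo m V) (ℚP.+-identityʳ (sumTo m U)) ⟩
    sumTo m U + sumTo m V                            ≡⟨ sumTo-+ m U V ⟨
    sumTo m (λ j → U j + V j)                        ≡⟨ sumTo-cong m U+V ⟩
    sumTo m (λ j → sign j * ff z (m ∸ j) * F X m j * (z - X (suc m)))
                                                     ≡⟨ sumTo-*ʳ m _ (z - X (suc m)) ⟨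
    sumTo m (λ j → sign j * ff z (m ∸ j) * F X m j) * (z - X (suc m))
                                                     ≡⟨ cong (_* (z - X (suc m))) (sumTo-F X m z) ⟩
    P X (suc m) z                                    ∎
    where
    c : ℕ → ℚ
    c j = X (suc m) - fromℕ (suc m) + fromℕ (suc j)
    L U V : ℕ → ℚ
    L j = sign j * ff z (suc m ∸ j) * F X (suc m) j
    U j = sign j * ff z (suc m ∸ j) * F X m j
    V j = (- sign j) * ff z (m ∸ j) * (c j * F X m j)

    L-suc : ∀ j → j ≤ m → L (suc j) ≡ U (suc j) + V j
    L-suc j j≤m = trans (cong ((- sign j) * ff z (m ∸ j) *_) (F-suc X m j j≤m))
                        (ℚP.*-distribˡ-+ ((- sign j) * ff z (m ∸ j)) (F X m (suc j)) (c j * F X m j))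

    U-top : U (suc m) ≡ 0ℚ
    U-top = trans (cong (sign (suc m) * ff z (m ∸ m) *_) (F-above X m)) (ℚP.*-zeroʳ (sign (suc m) * ff z (m ∸ m)))

    U+V : ∀ j → j ≤ m → U j + V j ≡ sign j * ff z (m ∸ j) * F X m j * (z - X (suc m))
    U+V j j≤m = begin
      sign j * ff z (suc m ∸ j) * F X m j + V j
        ≡⟨ cong (λ k → sign j * ff z k * F X m j + V j) (ℕP.+-∸-assoc 1 j≤m) ⟩
      sign j * (ff z (m ∸ j) * (z - fromℕ (m ∸ j))) * F X m j + V j
        ≡⟨ cong₂ (λ a b → sign j * (ff z (m ∸ j) * (z - a)) * F X m j
                          + (- sign j) * ff z (m ∸ j) * ((X (suc m) - b + fromℕ (suc j)) * F X m j))
                 (fromℕ-∸ j≤m) (fromℕ-+ 1 m) ⟩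
      sign j * (ff z (m ∸ j) * (z - (fromℕ m - fromℕ j))) * F X m j
        + (- sign j) * ff z (m ∸ j) * ((X (suc m) - (1ℚ + fromℕ m) + fromℕ (suc j)) * F X m j)
        ≡⟨ cong (λ b → sign j * (ff z (m ∸ j) * (z - (fromℕ m - fromℕ j))) * F X m j
                        + (- sign j) * ff z (m ∸ j) * ((X (suc m) - (1ℚ + fromℕ m) + b) * F X m j)) (fromℕ-+ 1 j) ⟩
      sign j * (ff z (m ∸ j) * (z - (fromℕ m - fromℕ j))) * F X m j
        + (- sign j) * ff z (m ∸ j) * ((X (suc m) - (1ℚ + fromℕ m) + (1ℚ + fromℕ j)) * F X m j)
        ≡⟨ collect (sign j) (ff z (m ∸ j)) (F X m j) z (X (suc m)) (fromℕ m) (fromℕ j) ⟩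
      sign j * ff z (m ∸ j) * F X m j * (z - X (suc m)) ∎
      where
      collect : ∀ s f φ z x a b →
                s * (f * (z - (a - b))) * φ + (- s) * f * ((x - (1ℚ + a) + (1ℚ + b)) * φ) ≡ s * f * φ * (z - x)
      collect = solve 7 (λ s f φ z x a b →
        s :* (f :* (z :- (a :- b))) :* φ :+ (:- s) :* f :* ((x :- (con 1ℚ :+ a) :+ (con 1ℚ :+ b)) :* φ)
          := s :* f :* φ :* (z :- x)) refl

  prodFrom1-zero : ∀ m (f : ℕ → ℚ) k → 1 ≤ k → k ≤ m → f k ≡ 0ℚ → prodFrom1 m f ≡ 0ℚ
  prodFrom1-zero zero    f (suc k) _ () _
  prodFrom1-zero (suc m) f k 1≤k k≤1+m fk≡0 with k ℕ.≟ suc m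
  ... | yes refl = trans (cong (prodFrom1 m f *_) fk≡0) (ℚP.*-zeroʳ (prodFrom1 m f))
  ... | no k≢1+m = trans (cong (_* f (suc m)) (prodFrom1-zero m f k 1≤k (ℕP.≤-pred (ℕP.≤∧≢⇒< k≤1+m k≢1+m)) fk≡0))
                         (ℚP.*-zeroˡ (f (suc m)))

  nth1-∈ : ∀ {d} (xs : List ℕ) → d ∈ xs → ∃ λ k → 1 ≤ k × k ≤ length xs × nth1 xs k ≡ fromℕ d
  nth1-∈ (x ∷ xs) (here refl) = 1 , ℕP.≤-refl , ℕ.s≤s ℕ.z≤n , refl
  nth1-∈ (x ∷ xs) (there d∈xs) with nth1-∈ xs d∈xs
  ... | suc k , _ , k≤ , eq = suc (suc k) , ℕ.s≤s ℕ.z≤n , ℕ.s≤s k≤ , eq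

  P-root : ∀ {d} (xs : List ℕ) → d ∈ xs → P (nth1 xs) (length xs) (fromℕ d) ≡ 0ℚ
  P-root {d} xs d∈xs with nth1-∈ xs d∈xs
  ... | k , 1≤k , k≤ , eq =
    prodFrom1-zero (length xs) _ k 1≤k k≤ (trans (cong (λ w → fromℕ d - w) eq) (ℚP.+-inverseʳ (fromℕ d)))

  fromℕ-sum : ∀ {N} (f : Fin N → ℕ) → fromℕ (ℕΣ.sum f) ≡ ∑[ r < N ] fromℕ (f r)
  fromℕ-sum {zero}  f = refl
  fromℕ-sum {suc N} f = trans (fromℕ-+ (f Fin.zero) _) (cong (fromℕ (f Fin.zero) +_) (fromℕ-sum (f ∘ Fin.suc)))

  sumTo-∑-comm : ∀ m {N} (g : ℕ → Fin N → ℚ) → sumTo m (λ j → ∑[ r < N ] g j r) ≡ ∑[ r < N ] sumTo m (λ j → g j r)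
  sumTo-∑-comm zero    g = refl
  sumTo-∑-comm (suc m) g = trans (cong (_+ ∑[ r < _ ] g (suc m) r) (sumTo-∑-comm m g))
                                 (sym (∑-distrib-+ (λ r → sumTo m (λ j → g j r)) (g (suc m))))

module Identities {n q t s : ℕ} (2≤q : 2 ≤ q) (t≤n : t ≤ n) (x : Word n q) (C′ : List (Word n q))
                  (unique : Unique (x ∷ C′)) (design : IsDesign t (x ∷ C′))
                  (xs : List ℕ) (length≡s : length xs ≡ s) (xs⇔S′ : ∀ d → (d ∈ xs) ⇔ InS' (x ∷ C′) d) where

  open import Data.Nat using (_+_; _*_; _^_)
  open import Data.Rational as ℚ using (ℚ; 0ℚ; 1ℚ; _-_)
  open import Algebra.Properties.Semiring.Sum (CommutativeRing.semiring ℚP.+-*-commutativeRing)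
  import Algebra.Properties.Semiring.Sum ℕP.+-*-semiring as ℕΣ
  open Counting
  open Counting.Moments (List.lookup (x ∷ C′))
  open Rational
  open ≡-Reasoning

  N : ℕ
  N = length (x ∷ C′)

  X : ℕ → ℚ
  X = nth1 xs

  A D : Fin N → ℕ
  A r = n ∸ ham x (List.lookup (x ∷ C′) r)
  D r = ham x (List.lookup (x ∷ C′) r)

  instance
    q≢0 : ℕ.NonZero q
    q≢0 = ℕ.>-nonZero (ℕP.≤-trans (ℕP.n≤1+n 1) 2≤q)
    q-1≢0 : ℕ.NonZero (q ∸ 1)
    q-1≢0 = ℕ.>-nonZero (ℕP.∸-monoˡ-≤ 1 2≤q)

  balanced : Balanced t
  balanced = design⇒balanced (x ∷ C′) t≤n design

  K : ℕ → ℕ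
  K ℓ = (n P′ ℓ) * (q ∸ 1) ^ ℓ

  W : ℕ → Fin N → ℚ
  W ℓ r = fromℕ (q ^ ℓ * (D r P′ ℓ))

  lam-moment : ∀ i ℓ → i + ℓ ≤ t →
               lam N q i ℚ.* fromℕ (((n ∸ ℓ) P′ i) * K ℓ) ≡ ∑[ r < N ] (fromℕ (A r P′ i) ℚ.* W ℓ r)
  lam-moment i ℓ bound = begin
    frac N (q ^ i) ℚ.* fromℕ (((n ∸ ℓ) P′ i) * K ℓ)
      ≡⟨ frac-* N (q ^ i) _ _ {{ℕP.m^n≢0 q i}} scaled ⟩
    fromℕ (q ^ ℓ * S)
      ≡⟨ cong fromℕ (ℕΣ.*-distribˡ-sum (q ^ ℓ) (λ r → (A r P′ i) * (D r P′ ℓ))) ⟩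
    fromℕ (ℕΣ.sum (λ r → q ^ ℓ * ((A r P′ i) * (D r P′ ℓ))))
      ≡⟨ fromℕ-sum (λ r → q ^ ℓ * ((A r P′ i) * (D r P′ ℓ))) ⟩
    ∑[ r < N ] fromℕ (q ^ ℓ * ((A r P′ i) * (D r P′ ℓ)))
      ≡⟨ sum-cong-≗ (λ r → trans (cong fromℕ (x∙yz≈y∙xz (q ^ ℓ) (A r P′ i) (D r P′ ℓ))) (fromℕ-* (A r P′ i) _)) ⟩
    ∑[ r < N ] (fromℕ (A r P′ i) ℚ.* W ℓ r) ∎
    where
    S = ℕΣ.sum (λ r → (A r P′ i) * (D r P′ ℓ))
    scaled : q ^ i * (q ^ ℓ * S) ≡ N * (((n ∸ ℓ) P′ i) * K ℓ)
    scaled = begin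
      q ^ i * (q ^ ℓ * S)                          ≡⟨ ℕP.*-assoc (q ^ i) (q ^ ℓ) S ⟨
      q ^ i * q ^ ℓ * S                            ≡⟨ cong (_* S) (ℕP.^-distribˡ-+-* q i ℓ) ⟨
      q ^ (i + ℓ) * S                              ≡⟨ moment-formula-ham x balanced i ℓ bound ⟩
      N * ((n P′ (i + ℓ)) * (q ∸ 1) ^ ℓ)           ≡⟨ cong (λ k → N * ((n P′ k) * (q ∸ 1) ^ ℓ)) (ℕP.+-comm i ℓ) ⟩
      N * ((n P′ (ℓ + i)) * (q ∸ 1) ^ ℓ)           ≡⟨ cong (λ z → N * (z * (q ∸ 1) ^ ℓ)) (P′-+ n ℓ i) ⟩
      N * ((n P′ ℓ) * ((n ∸ ℓ) P′ i) * (q ∸ 1) ^ ℓ) ≡⟨ cong (N *_) (shuffle (n P′ ℓ) _ _) ⟩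
      N * (((n ∸ ℓ) P′ i) * K ℓ)                   ∎
      where
      shuffle : ∀ a b c → a * b * c ≡ b * (a * c)
      shuffle a b c = trans (cong (_* c) (ℕP.*-comm a b)) (ℕP.*-assoc b a c)

  key-identity : ∀ ℓ → s + ℓ ≤ t →
    sumTo s (λ j → sign j ℚ.* ff (fromℕ (n ∸ ℓ)) (s ∸ j) ℚ.* lam N q (s ∸ j) ℚ.* F X s j) ℚ.* fromℕ (K ℓ) ≡
    ∑[ r < N ] (P X s (fromℕ (A r)) ℚ.* W ℓ r)
  key-identity ℓ bound = begin
    sumTo s (λ j → sign j ℚ.* ff (fromℕ (n ∸ ℓ)) (s ∸ j) ℚ.* lam N q (s ∸ j) ℚ.* F X s j) ℚ.* fromℕ (K ℓ)
      ≡⟨ sumTo-*ʳ s _ (fromℕ (K ℓ)) ⟩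
    sumTo s (λ j → sign j ℚ.* ff (fromℕ (n ∸ ℓ)) (s ∸ j) ℚ.* lam N q (s ∸ j) ℚ.* F X s j ℚ.* fromℕ (K ℓ))
      ≡⟨ sumTo-cong s term ⟩
    sumTo s (λ j → ∑[ r < N ] (sign j ℚ.* ff (fromℕ (A r)) (s ∸ j) ℚ.* F X s j ℚ.* W ℓ r))
      ≡⟨ sumTo-∑-comm s (λ j r → sign j ℚ.* ff (fromℕ (A r)) (s ∸ j) ℚ.* F X s j ℚ.* W ℓ r) ⟩
    ∑[ r < N ] sumTo s (λ j → sign j ℚ.* ff (fromℕ (A r)) (s ∸ j) ℚ.* F X s j ℚ.* W ℓ r)
      ≡⟨ sum-cong-≗ (λ r → trans (sym (sumTo-*ʳ s _ (W ℓ r))) (cong (ℚ._* W ℓ r) (sumTo-F X s (fromℕ (A r))))) ⟩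
    ∑[ r < N ] (P X s (fromℕ (A r)) ℚ.* W ℓ r) ∎
    where
    term : ∀ j → j ≤ s →
           sign j ℚ.* ff (fromℕ (n ∸ ℓ)) (s ∸ j) ℚ.* lam N q (s ∸ j) ℚ.* F X s j ℚ.* fromℕ (K ℓ) ≡
           ∑[ r < N ] (sign j ℚ.* ff (fromℕ (A r)) (s ∸ j) ℚ.* F X s j ℚ.* W ℓ r)
    term j _ = begin
      σ ℚ.* ff (fromℕ (n ∸ ℓ)) i ℚ.* lam N q i ℚ.* φ ℚ.* fromℕ (K ℓ)
        ≡⟨ regroup σ (ff (fromℕ (n ∸ ℓ)) i) (lam N q i) φ (fromℕ (K ℓ)) ⟩
      (σ ℚ.* φ) ℚ.* (lam N q i ℚ.* (ff (fromℕ (n ∸ ℓ)) i ℚ.* fromℕ (K ℓ)))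
        ≡⟨ cong (λ z → (σ ℚ.* φ) ℚ.* (lam N q i ℚ.* (z ℚ.* fromℕ (K ℓ)))) (ff-fromℕ (n ∸ ℓ) i) ⟩
      (σ ℚ.* φ) ℚ.* (lam N q i ℚ.* (fromℕ ((n ∸ ℓ) P′ i) ℚ.* fromℕ (K ℓ)))
        ≡⟨ cong (λ z → (σ ℚ.* φ) ℚ.* (lam N q i ℚ.* z)) (fromℕ-* ((n ∸ ℓ) P′ i) (K ℓ)) ⟨
      (σ ℚ.* φ) ℚ.* (lam N q i ℚ.* fromℕ (((n ∸ ℓ) P′ i) * K ℓ))
        ≡⟨ cong ((σ ℚ.* φ) ℚ.*_) (lam-moment i ℓ (ℕP.≤-trans (ℕP.+-monoˡ-≤ ℓ (ℕP.m∸n≤m s j)) bound)) ⟩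
      (σ ℚ.* φ) ℚ.* ∑[ r < N ] (fromℕ (A r P′ i) ℚ.* W ℓ r)
        ≡⟨ *-distribˡ-sum (σ ℚ.* φ) (λ r → fromℕ (A r P′ i) ℚ.* W ℓ r) ⟩
      ∑[ r < N ] ((σ ℚ.* φ) ℚ.* (fromℕ (A r P′ i) ℚ.* W ℓ r))
        ≡⟨ sum-cong-≗ (λ r → trans (cong (λ z → (σ ℚ.* φ) ℚ.* (z ℚ.* W ℓ r)) (sym (ff-fromℕ (A r) i)))
                                   (regroup′ σ φ (ff (fromℕ (A r)) i) (W ℓ r))) ⟩
      ∑[ r < N ] (σ ℚ.* ff (fromℕ (A r)) i ℚ.* φ ℚ.* W ℓ r) ∎
      where
      i = s ∸ j
      σ = sign j
      φ = F X s j
      regroup : ∀ a b c d e → a ℚ.* b ℚ.* c ℚ.* d ℚ.* e ≡ (a ℚ.* d) ℚ.* (c ℚ.* (b ℚ.* e))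
      regroup = solve 5 (λ a b c d e → a :* b :* c :* d :* e := (a :* d) :* (c :* (b :* e))) refl
      regroup′ : ∀ a d b w → (a ℚ.* d) ℚ.* (b ℚ.* w) ≡ a ℚ.* b ℚ.* d ℚ.* w
      regroup′ = solve 4 (λ a d b w → (a :* d) :* (b :* w) := a :* b :* d :* w) refl

  ∑-collapses-to-x : ∀ (w : Fin N → ℚ) → ∑[ r < N ] (P X s (fromℕ (A r)) ℚ.* w r) ≡ P X s (fromℕ n) ℚ.* w Fin.zero
  ∑-collapses-to-x w = begin
    P X s (fromℕ (A Fin.zero)) ℚ.* w Fin.zero ℚ.+ ∑[ r < length C′ ] (P X s (fromℕ (A (Fin.suc r))) ℚ.* w (Fin.suc r))
      ≡⟨ cong₂ (λ h z → P X s (fromℕ (n ∸ h)) ℚ.* w Fin.zero ℚ.+ z) (ham-refl x)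
               (sum-cong-≗ (λ r → trans (cong (ℚ._* w (Fin.suc r)) (root r)) (ℚP.*-zeroˡ (w (Fin.suc r))))) ⟩
    P X s (fromℕ n) ℚ.* w Fin.zero ℚ.+ ∑[ r < length C′ ] 0ℚ
      ≡⟨ cong (P X s (fromℕ n) ℚ.* w Fin.zero ℚ.+_) (sum-replicate-zero (length C′)) ⟩
    P X s (fromℕ n) ℚ.* w Fin.zero ℚ.+ 0ℚ
      ≡⟨ ℚP.+-identityʳ _ ⟩
    P X s (fromℕ n) ℚ.* w Fin.zero ∎
    where
    x∉C′ : All (x ≢_) C′
    x∉C′ = AllPairs.head unique
    root : ∀ r → P X s (fromℕ (A (Fin.suc r))) ≡ 0ℚ
    root r = subst (λ k → P X k (fromℕ (A (Fin.suc r))) ≡ 0ℚ) length≡s (P-root xs (Equivalence.from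
      (xs⇔S′ (A (Fin.suc r)))
      (x , List.lookup C′ r , here refl , there (∈-lookup r) , All.lookup x∉C′ (∈-lookup r) , refl)))

  part₁ : s ≤ t →
    sumTo s (λ j → sign j ℚ.* ff (fromℕ n) (s ∸ j) ℚ.* lam N q (s ∸ j) ℚ.* F X s j) ≡ P X s (fromℕ n)
  part₁ s≤t = begin
    G                                          ≡⟨ ℚP.*-identityʳ G ⟨
    G ℚ.* 1ℚ                                   ≡⟨ key-identity 0 (subst (_≤ t) (sym (ℕP.+-identityʳ s)) s≤t) ⟩
    ∑[ r < N ] (P X s (fromℕ (A r)) ℚ.* W 0 r)  ≡⟨ ∑-collapses-to-x (W 0) ⟩
    P X s (fromℕ n) ℚ.* 1ℚ                     ≡⟨ ℚP.*-identityʳ (P X s (fromℕ n)) ⟩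
    P X s (fromℕ n)                            ∎
    where G = sumTo s (λ j → sign j ℚ.* ff (fromℕ n) (s ∸ j) ℚ.* lam N q (s ∸ j) ℚ.* F X s j)

  part₂ : 2 * s ∸ 1 ≤ t → ∀ ℓ → 1 ≤ ℓ → ℓ ≤ s ∸ 1 →
    sumTo s (λ j → sign j ℚ.* ff (fromℕ n - fromℕ ℓ) (s ∸ j) ℚ.* lam N q (s ∸ j) ℚ.* F X s j) ≡ 0ℚ
  part₂ bound ℓ 1≤ℓ ℓ≤s-1 = *-fromℕ-cancelʳ G (K ℓ) {{K≢0}} (begin
    G ℚ.* fromℕ (K ℓ)
      ≡⟨ cong (λ z → sumTo s (λ j → sign j ℚ.* ff z (s ∸ j) ℚ.* lam N q (s ∸ j) ℚ.* F X s j) ℚ.* fromℕ (K ℓ))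
              (fromℕ-∸ ℓ≤n) ⟨
    sumTo s (λ j → sign j ℚ.* ff (fromℕ (n ∸ ℓ)) (s ∸ j) ℚ.* lam N q (s ∸ j) ℚ.* F X s j) ℚ.* fromℕ (K ℓ)
      ≡⟨ key-identity ℓ s+ℓ≤t ⟩
    ∑[ r < N ] (P X s (fromℕ (A r)) ℚ.* W ℓ r)
      ≡⟨ ∑-collapses-to-x (W ℓ) ⟩
    P X s (fromℕ n) ℚ.* fromℕ (q ^ ℓ * (ham x x P′ ℓ))
      ≡⟨ cong (λ h → P X s (fromℕ n) ℚ.* fromℕ (q ^ ℓ * (h P′ ℓ))) (ham-refl x) ⟩
    P X s (fromℕ n) ℚ.* fromℕ (q ^ ℓ * (0 P′ ℓ))
      ≡⟨ cong (λ z → P X s (fromℕ n) ℚ.* fromℕ z) (trans (cong (q ^ ℓ *_) (P′-vanishes 1≤ℓ)) (ℕP.*-zeroʳ (q ^ ℓ))) ⟩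
    P X s (fromℕ n) ℚ.* 0ℚ
      ≡⟨ ℚP.*-zeroʳ (P X s (fromℕ n)) ⟩
    0ℚ ∎)
    where
    G = sumTo s (λ j → sign j ℚ.* ff (fromℕ n - fromℕ ℓ) (s ∸ j) ℚ.* lam N q (s ∸ j) ℚ.* F X s j)
    m+[m∸1]≡2m∸1 : ∀ m → m + (m ∸ 1) ≡ 2 * m ∸ 1
    m+[m∸1]≡2m∸1 zero    = refl
    m+[m∸1]≡2m∸1 (suc m) = trans (sym (ℕP.+-suc m m)) (cong (m +_) (sym (ℕP.*-identityˡ (suc m))))
    s+ℓ≤t : s + ℓ ≤ t
    s+ℓ≤t = ℕP.≤-trans (ℕP.+-monoʳ-≤ s ℓ≤s-1) (subst (_≤ t) (sym (m+[m∸1]≡2m∸1 s)) bound)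
    ℓ≤n : ℓ ≤ n
    ℓ≤n = ℕP.≤-trans (ℕP.m≤n+m ℓ s) (ℕP.≤-trans s+ℓ≤t t≤n)
    K≢0 : ℕ.NonZero (K ℓ)
    K≢0 = ℕP.m*n≢0 (n P′ ℓ) ((q ∸ 1) ^ ℓ) {{P′-nonZero ℓ≤n}} {{ℕP.m^n≢0 (q ∸ 1) ℓ}}

open import Data.Rational using (ℚ; 0ℚ; _*_; _-_)

lemma4p5 : (n q s t : ℕ) → 1 ≤ n → 2 ≤ q → 1 ≤ s → 1 ≤ t → t ≤ n →
    (C : List (Word n q)) → Unique C → ¬ (C ≡ []) →
    IsDesign t C → degree C ≡ s →
    (xs : List ℕ) → Unique xs → length xs ≡ s → (∀ d → (d ∈ xs) ⇔ InS' C d) →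
    ((s ≤ t →
        sumTo s (λ j → sign j * ff (fromℕ n) (s ∸ j)
                        * lam (length C) q (s ∸ j)
                        * F (nth1 xs) s j)
          ≡ P (nth1 xs) s (fromℕ n))
     × (2 ℕ.* s ∸ 1 ≤ t → (ℓ : ℕ) → 1 ≤ ℓ → ℓ ≤ s ∸ 1 →
        sumTo s (λ j → sign j * ff (fromℕ n - fromℕ ℓ) (s ∸ j)
                        * lam (length C) q (s ∸ j)
                        * F (nth1 xs) s j)
          ≡ 0ℚ))
lemma4p5 n q s t _ _   _ _ _   []       _      C≢[] = ⊥-elim (C≢[] refl)
lemma4p5 n q s t _ 2≤q _ _ t≤n (x ∷ C′) unique _ design _ xs _ length≡s xs⇔S′ = part₁ , part₂
  where open Identities 2≤q t≤n x C′ unique design xs length≡s xs⇔S′
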